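{- Let $n$ be a positive integer and $0\le k\le n$. Let $c(n,k)$ be the number of compositions of $n$ (ordered tuples of positive integers summing to $n$) having exactly $k$ parts equal to $1$. Then \[c(n,k)=\sum_{j_1+j_2+\cdots+j_{k+1}=n-2k-1}f_{j_1}f_{j_2}\cdots f_{j_{k+1}},\] where the sum is over all integer tuples $(j_1,\ldots,j_{k+1})$ with $j_t\ge -1$ for all $t$ and $j_1+\cdots+j_{k+1}=n-2k-1$.
   Context: Fibonacci numbers: $f_{ -1}=1$, $f_0=0$, $f_1=1$, $f_{m+1}=f_m+f_{m-1}$. -}

module Defs where

open import Data.Nat using (ℕ; zero; suc; _+_; _*_; _∸_; _≡ᵇ_)
open import Data.Integer using (ℤ; +_; -[1+_])
open import Data.List using (List; []; _∷_; map; concatMap; filterᵇ; length; upTo)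
open import Data.Nat.ListAction using (sum)

fibℕ : ℕ → ℕ
fibℕ zero = 0
fibℕ (suc zero) = 1
fibℕ (suc (suc m)) = fibℕ (suc m) + fibℕ m

-- f_j for an integer j; only ever applied to j ≥ -1 (f_{-1} = 1).
-- (For j ≤ -2 the value is never used; it is set to 0.)
fib : ℤ → ℕ
fib (+ m) = fibℕ m
fib -[1+ zero ] = 1
fib -[1+ suc _ ] = 0

-- compsFuel fuel m : all lists of positive naturals summing to m
-- (first part p ∈ {1,…,m}, then a composition of m - p); correct whenever m ≤ fuel.
compsFuel : ℕ → ℕ → List (List ℕ)
compsFuel _ zero = [] ∷ []
compsFuel zero (suc m) = []
compsFuel (suc fuel) (suc m) =
  concatMap (λ i → map (λ c → suc i ∷ c) (compsFuel fuel (m ∸ i))) (upTo (suc m))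

compositions : ℕ → List (List ℕ)
compositions n = compsFuel n n

onesIn : List ℕ → ℕ
onesIn [] = 0
onesIn (x ∷ xs) = (if1 x) + onesIn xs
  where
  if1 : ℕ → ℕ
  if1 (suc zero) = 1
  if1 _ = 0

c : ℕ → ℕ → ℕ
c n k = length (filterᵇ (λ comp → onesIn comp ≡ᵇ k) (compositions n))

-- A tuple with j_t ≥ -1 is written j_t = i_t - 1 with i_t ∈ ℕ, i.e. Σ i_t = s + r.
-- weakSum r m = Σ over (i_1,…,i_r) ∈ ℕ^r with Σ i_t = m of ∏ f_{i_t - 1}.
fibShift : ℕ → ℕ
fibShift i = fib (-[1+ 0 ] Data.Integer.+ + i)

weakSum : ℕ → ℕ → ℕ
weakSum zero zero = 1
weakSum zero (suc _) = 0
weakSum (suc r) m = sum (map (λ i → fibShift i * weakSum r (m ∸ i)) (upTo (suc m)))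

fibConvolution : ℕ → ℤ → ℕ
fibConvolution r s with s Data.Integer.+ + r
... | + m = weakSum r m
... | -[1+ _ ] = 0

-- The compositions of n with no part equal to 1 have generating function
-- G(x) = 1 / (1 − x²/(1 − x)) = (1 − x)/(1 − x − x²), whose coefficients are f_{j−1}.
-- A composition with exactly k ones splits at its ones into k + 1 such compositions,
-- so c(n, k) = [xⁿ] xᵏ G(x)^{k+1}, which is the stated sum once each j_t is shifted by one.
-- Splitting off the first part gives c(n+1, k) = c(n, k−1) + Σ_{i<n} c(i, k), and the coefficients
-- of xᵏ G^{k+1} obey the same recurrence because G = 1 + x²/(1 − x) · G, i.e. f_n = Σ_{i<n} f_{i−1}.
module Submission where

open import Defs
open import Data.Nat using (ℕ; suc; _≤_)
open import Data.Integer using (ℤ; +_; _-_)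
open import Relation.Binary.PropositionalEquality using (_≡_)

open import Data.Nat using (zero; _+_; _*_; _∸_; _≡ᵇ_; z≤n; s≤s)
open import Data.Nat.Properties
open import Algebra.Properties.CommutativeSemigroup +-commutativeSemigroup using (interchange)
open import Data.Bool using (Bool; true; false; T?)
open import Data.List using (List; []; _∷_; map; concatMap; filterᵇ; length; upTo; applyUpTo; _++_)
open import Data.List.Properties using (length-++; filter-++)
open import Data.Nat.ListAction using (sum)
open import Function using (_∘_; id)
open import Relation.Binary.PropositionalEquality using (refl; subst; sym; trans; cong; cong₂; module ≡-Reasoning)
import Data.Integer as ℤ
import Data.Integer.Properties as ℤ
open import Data.Nat.Tactic.RingSolver using (solve-∀)
import Data.Integer.Tactic.RingSolver as ℤ-Solver

∑< : ℕ → (ℕ → ℕ) → ℕ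
∑< zero    f = 0
∑< (suc n) f = f 0 + ∑< n (f ∘ suc)

partialSums : (ℕ → ℕ) → ℕ → ℕ
partialSums f n = ∑< n f

∑<-cong : ∀ n {f g : ℕ → ℕ} → (∀ i → f i ≡ g i) → ∑< n f ≡ ∑< n g
∑<-cong zero    f≗g = refl
∑<-cong (suc n) f≗g = cong₂ _+_ (f≗g 0) (∑<-cong n (f≗g ∘ suc))

∑<-snoc : ∀ n (f : ℕ → ℕ) → ∑< (suc n) f ≡ ∑< n f + f n
∑<-snoc zero    f = +-comm (f 0) 0
∑<-snoc (suc n) f = trans (cong (λ t → f 0 + t) (∑<-snoc n (f ∘ suc))) (sym (+-assoc (f 0) _ _))

∑<-reverse : ∀ n (f : ℕ → ℕ) → ∑< n (λ i → f (n ∸ suc i)) ≡ ∑< n f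
∑<-reverse zero    f = refl
∑<-reverse (suc n) f = begin
  f n + ∑< n (λ i → f (n ∸ suc i)) ≡⟨ cong (λ t → f n + t) (∑<-reverse n f) ⟩
  f n + ∑< n f                     ≡⟨ +-comm (f n) _ ⟩
  ∑< n f + f n                     ≡⟨ sym (∑<-snoc n f) ⟩
  ∑< (suc n) f                     ∎
  where open ≡-Reasoning

sum-map-applyUpTo : ∀ n (g f : ℕ → ℕ) → sum (map g (applyUpTo f n)) ≡ ∑< n (g ∘ f)
sum-map-applyUpTo zero    g f = refl
sum-map-applyUpTo (suc n) g f = cong (λ t → g (f 0) + t) (sum-map-applyUpTo n g (f ∘ suc))

-- Sequences ℕ → ℕ are read as formal power series; _⊛_ is the Cauchy product.
_⊛_ : (ℕ → ℕ) → (ℕ → ℕ) → ℕ → ℕ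
(a ⊛ b) zero    = a 0 * b 0
(a ⊛ b) (suc m) = a 0 * b (suc m) + ((a ∘ suc) ⊛ b) m

⊛-cong : ∀ m {a a′ b b′ : ℕ → ℕ} → (∀ i → a i ≡ a′ i) → (∀ i → b i ≡ b′ i) →
         (a ⊛ b) m ≡ (a′ ⊛ b′) m
⊛-cong zero    a≗a′ b≗b′ = cong₂ _*_ (a≗a′ 0) (b≗b′ 0)
⊛-cong (suc m) a≗a′ b≗b′ =
  cong₂ _+_ (cong₂ _*_ (a≗a′ 0) (b≗b′ (suc m))) (⊛-cong m (a≗a′ ∘ suc) b≗b′)

sum-upTo-⊛ : ∀ m (a b : ℕ → ℕ) → sum (map (λ i → a i * b (m ∸ i)) (upTo (suc m))) ≡ (a ⊛ b) m
sum-upTo-⊛ m a b = trans (sum-map-applyUpTo (suc m) (λ i → a i * b (m ∸ i)) id) (go m a)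
  where
  go : ∀ m (a : ℕ → ℕ) → ∑< (suc m) (λ i → a i * b (m ∸ i)) ≡ (a ⊛ b) m
  go zero    a = +-identityʳ _
  go (suc m) a = cong (λ t → a 0 * b (suc m) + t) (go m (a ∘ suc))

⊛-distribʳ-+ : ∀ m (f g c : ℕ → ℕ) → ((λ j → f j + g j) ⊛ c) m ≡ (f ⊛ c) m + (g ⊛ c) m
⊛-distribʳ-+ zero    f g c = *-distribʳ-+ (c 0) (f 0) (g 0)
⊛-distribʳ-+ (suc m) f g c = begin
  (f 0 + g 0) * c (suc m) + ((λ j → f (suc j) + g (suc j)) ⊛ c) m
    ≡⟨ cong₂ _+_ (*-distribʳ-+ (c (suc m)) (f 0) (g 0)) (⊛-distribʳ-+ m (f ∘ suc) (g ∘ suc) c) ⟩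
  (f 0 * c (suc m) + g 0 * c (suc m)) + (((f ∘ suc) ⊛ c) m + ((g ∘ suc) ⊛ c) m)
    ≡⟨ interchange (f 0 * c (suc m)) (g 0 * c (suc m)) _ _ ⟩
  (f 0 * c (suc m) + ((f ∘ suc) ⊛ c) m) + (g 0 * c (suc m) + ((g ∘ suc) ⊛ c) m) ∎
  where open ≡-Reasoning

⊛-*ˡ : ∀ m s (f c : ℕ → ℕ) → ((λ j → s * f j) ⊛ c) m ≡ s * (f ⊛ c) m
⊛-*ˡ zero    s f c = *-assoc s (f 0) (c 0)
⊛-*ˡ (suc m) s f c = begin
  s * f 0 * c (suc m) + ((λ j → s * f (suc j)) ⊛ c) m
    ≡⟨ cong₂ _+_ (*-assoc s (f 0) _) (⊛-*ˡ m s (f ∘ suc) c) ⟩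
  s * (f 0 * c (suc m)) + s * ((f ∘ suc) ⊛ c) m
    ≡⟨ sym (*-distribˡ-+ s _ _) ⟩
  s * (f 0 * c (suc m) + ((f ∘ suc) ⊛ c) m) ∎
  where open ≡-Reasoning

⊛-assoc : ∀ m (a b c : ℕ → ℕ) → ((a ⊛ b) ⊛ c) m ≡ (a ⊛ (b ⊛ c)) m
⊛-assoc zero    a b c = *-assoc (a 0) (b 0) (c 0)
⊛-assoc (suc m) a b c = begin
  a 0 * b 0 * c (suc m) + ((λ j → a 0 * b (suc j) + ((a ∘ suc) ⊛ b) j) ⊛ c) m
    ≡⟨ cong (λ t → a 0 * b 0 * c (suc m) + t) (⊛-distribʳ-+ m _ _ c) ⟩
  a 0 * b 0 * c (suc m) + (((λ j → a 0 * b (suc j)) ⊛ c) m + (((a ∘ suc) ⊛ b) ⊛ c) m)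
    ≡⟨ cong₂ (λ x y → a 0 * b 0 * c (suc m) + (x + y))
             (⊛-*ˡ m (a 0) (b ∘ suc) c) (⊛-assoc m (a ∘ suc) b c) ⟩
  a 0 * b 0 * c (suc m) + (a 0 * ((b ∘ suc) ⊛ c) m + ((a ∘ suc) ⊛ (b ⊛ c)) m)
    ≡⟨ regroup (a 0) (b 0) (c (suc m)) _ _ ⟩
  a 0 * (b 0 * c (suc m) + ((b ∘ suc) ⊛ c) m) + ((a ∘ suc) ⊛ (b ⊛ c)) m ∎
  where
  open ≡-Reasoning
  regroup : ∀ x y z u v → x * y * z + (x * u + v) ≡ x * (y * z + u) + v
  regroup = solve-∀

δ : ℕ → ℕ
δ zero    = 1
δ (suc _) = 0

δ-⊛ : ∀ m (c : ℕ → ℕ) → (δ ⊛ c) m ≡ c m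
δ-⊛ zero    c = +-identityʳ _
δ-⊛ (suc m) c = trans (cong₂ _+_ (+-identityʳ _) (zero-⊛ m)) (+-identityʳ _)
  where
  zero-⊛ : ∀ m → ((λ _ → 0) ⊛ c) m ≡ 0
  zero-⊛ zero    = refl
  zero-⊛ (suc m) = zero-⊛ m

ones-⊛ : ∀ m (c : ℕ → ℕ) → ((λ _ → 1) ⊛ c) m ≡ ∑< (suc m) c
ones-⊛ zero    c = refl
ones-⊛ (suc m) c = begin
  (c (suc m) + 0) + ((λ _ → 1) ⊛ c) m ≡⟨ cong₂ _+_ (+-identityʳ _) (ones-⊛ m c) ⟩
  c (suc m) + ∑< (suc m) c            ≡⟨ +-comm (c (suc m)) _ ⟩
  ∑< (suc m) c + c (suc m)            ≡⟨ sym (∑<-snoc (suc m) c) ⟩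
  ∑< (suc (suc m)) c                  ∎
  where open ≡-Reasoning

shift : ℕ → (ℕ → ℕ) → ℕ → ℕ
shift zero    S n       = S n
shift (suc k) S zero    = 0
shift (suc k) S (suc n) = shift k S n

shift-≥ : ∀ {k n} (S : ℕ → ℕ) → k ≤ n → shift k S n ≡ S (n ∸ k)
shift-≥ S z≤n       = refl
shift-≥ S (s≤s k≤n) = shift-≥ S k≤n

shift-+ : ∀ k (S A B : ℕ → ℕ) → (∀ m → S m ≡ A m + B m) →
          ∀ n → shift k S n ≡ shift k A n + shift k B n
shift-+ zero    S A B S≗A+B n       = S≗A+B n
shift-+ (suc k) S A B S≗A+B zero    = refl
shift-+ (suc k) S A B S≗A+B (suc n) = shift-+ k S A B S≗A+B n

shift-shift : ∀ k (S : ℕ → ℕ) n → shift k (shift 1 S) n ≡ shift (suc k) S n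
shift-shift zero    S n       = refl
shift-shift (suc k) S zero    = refl
shift-shift (suc k) S (suc n) = shift-shift k S n

partialSums-shift : ∀ k (S : ℕ → ℕ) n → partialSums (shift k S) n ≡ shift k (partialSums S) n
partialSums-shift zero    S n       = refl
partialSums-shift (suc k) S zero    = refl
partialSums-shift (suc k) S (suc n) = partialSums-shift k S n

-- shift 2 (λ _ → 1) is the series x²/(1 − x).
shift-ones-⊛ : ∀ j (X : ℕ → ℕ) → (shift 2 (λ _ → 1) ⊛ X) j ≡ shift 1 (partialSums X) j
shift-ones-⊛ zero          X = refl
shift-ones-⊛ (suc zero)    X = refl
shift-ones-⊛ (suc (suc m)) X = ones-⊛ m X

fibℕ≡∑<fibShift : ∀ n → fibℕ n ≡ ∑< n fibShift
fibℕ≡∑<fibShift zero          = refl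
fibℕ≡∑<fibShift (suc zero)    = refl
fibℕ≡∑<fibShift (suc (suc n)) = begin
  fibℕ (suc n) + fibℕ n                 ≡⟨ cong (λ t → t + fibℕ n) (fibℕ≡∑<fibShift (suc n)) ⟩
  ∑< (suc n) fibShift + fibShift (suc n) ≡⟨ sym (∑<-snoc (suc n) fibShift) ⟩
  ∑< (suc (suc n)) fibShift             ∎
  where open ≡-Reasoning

fibShift-rec : ∀ j → fibShift j ≡ δ j + (shift 2 (λ _ → 1) ⊛ fibShift) j
fibShift-rec zero    = refl
fibShift-rec (suc n) = trans (fibℕ≡∑<fibShift n) (sym (shift-ones-⊛ (suc n) fibShift))

fibShift-⊛-rec : ∀ (U : ℕ → ℕ) m →
  (fibShift ⊛ U) m ≡ U m + shift 1 (partialSums (fibShift ⊛ U)) m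
fibShift-⊛-rec U m = begin
  (fibShift ⊛ U) m                                           ≡⟨ ⊛-cong m fibShift-rec (λ _ → refl) ⟩
  ((λ j → δ j + (shift 2 (λ _ → 1) ⊛ fibShift) j) ⊛ U) m     ≡⟨ ⊛-distribʳ-+ m δ _ U ⟩
  (δ ⊛ U) m + ((shift 2 (λ _ → 1) ⊛ fibShift) ⊛ U) m         ≡⟨ cong₂ _+_ (δ-⊛ m U) (⊛-assoc m _ fibShift U) ⟩
  U m + (shift 2 (λ _ → 1) ⊛ (fibShift ⊛ U)) m               ≡⟨ cong (λ t → U m + t) (shift-ones-⊛ m (fibShift ⊛ U)) ⟩
  U m + shift 1 (partialSums (fibShift ⊛ U)) m               ∎
  where open ≡-Reasoning

weakSum-suc : ∀ r m → weakSum (suc r) m ≡ (fibShift ⊛ weakSum r) m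
weakSum-suc r m = sum-upTo-⊛ m fibShift (weakSum r)

weakSum-rec : ∀ r m → weakSum (suc r) m ≡ weakSum r m + shift 1 (partialSums (weakSum (suc r))) m
weakSum-rec r m = begin
  weakSum (suc r) m                                        ≡⟨ weakSum-suc r m ⟩
  (fibShift ⊛ weakSum r) m                                 ≡⟨ fibShift-⊛-rec (weakSum r) m ⟩
  weakSum r m + shift 1 (partialSums (fibShift ⊛ weakSum r)) m
    ≡⟨ cong (λ t → weakSum r m + t) (sym (partialSums-weakSum-suc m)) ⟩
  weakSum r m + shift 1 (partialSums (weakSum (suc r))) m  ∎
  where
  open ≡-Reasoning
  partialSums-weakSum-suc : ∀ m →
    shift 1 (partialSums (weakSum (suc r))) m ≡ shift 1 (partialSums (fibShift ⊛ weakSum r)) m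
  partialSums-weakSum-suc zero    = refl
  partialSums-weakSum-suc (suc j) = ∑<-cong j (weakSum-suc r)

-- [xⁿ] xᵏ G^{k+1}
fibCount : ℕ → ℕ → ℕ
fibCount k = shift k (weakSum (suc k))

-- The first summand is 0 for k = 0 and fibCount (k − 1) n otherwise.
fibCount-suc : ∀ k n → fibCount k (suc n) ≡ shift k (weakSum k) (suc n) + ∑< n (fibCount k)
fibCount-suc k n = begin
  shift k (weakSum (suc k)) (suc n)
    ≡⟨ shift-+ k _ _ _ (weakSum-rec k) (suc n) ⟩
  shift k (weakSum k) (suc n) + shift k (shift 1 (partialSums (weakSum (suc k)))) (suc n)
    ≡⟨ cong (λ t → shift k (weakSum k) (suc n) + t) (shift-shift k _ (suc n)) ⟩
  shift k (weakSum k) (suc n) + shift k (partialSums (weakSum (suc k))) n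
    ≡⟨ cong (λ t → shift k (weakSum k) (suc n) + t) (sym (partialSums-shift k (weakSum (suc k)) n)) ⟩
  shift k (weakSum k) (suc n) + ∑< n (fibCount k) ∎
  where open ≡-Reasoning

countWithOnes : ℕ → List (List ℕ) → ℕ
countWithOnes k L = length (filterᵇ (λ comp → onesIn comp ≡ᵇ k) L)

countWithOnes-++ : ∀ k (L M : List (List ℕ)) →
  countWithOnes k (L ++ M) ≡ countWithOnes k L + countWithOnes k M
countWithOnes-++ k L M = trans (cong length (filter-++ (T? ∘ hasOnes) L M)) (length-++ (filterᵇ hasOnes L))
  where
  hasOnes : List ℕ → Bool
  hasOnes comp = onesIn comp ≡ᵇ k

countWithOnes-concatMap : ∀ k (f : ℕ → List (List ℕ)) (xs : List ℕ) →
  countWithOnes k (concatMap f xs) ≡ sum (map (countWithOnes k ∘ f) xs)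
countWithOnes-concatMap k f []       = refl
countWithOnes-concatMap k f (x ∷ xs) =
  trans (countWithOnes-++ k (f x) (concatMap f xs))
        (cong (λ t → countWithOnes k (f x) + t) (countWithOnes-concatMap k f xs))

countWithOnes-map : ∀ {k k′} (g : List ℕ → List ℕ) →
  (∀ comp → (onesIn (g comp) ≡ᵇ k) ≡ (onesIn comp ≡ᵇ k′)) →
  ∀ L → countWithOnes k (map g L) ≡ countWithOnes k′ L
countWithOnes-map g same []      = refl
countWithOnes-map {k} {k′} g same (comp ∷ L)
  with onesIn (g comp) ≡ᵇ k | onesIn comp ≡ᵇ k′ | same comp
... | true  | true  | _ = cong suc (countWithOnes-map g same L)
... | false | false | _ = countWithOnes-map g same L

countWithOnes-1∷-zero : ∀ (L : List (List ℕ)) → countWithOnes 0 (map (1 ∷_) L) ≡ 0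
countWithOnes-1∷-zero []         = refl
countWithOnes-1∷-zero (comp ∷ L) = countWithOnes-1∷-zero L

countWithOnes-compsFuel : ∀ fuel n → n ≤ fuel → ∀ k → countWithOnes k (compsFuel fuel n) ≡ fibCount k n
countWithOnes-compsFuel fuel       zero    _         zero    = refl
countWithOnes-compsFuel fuel       zero    _         (suc k) = refl
countWithOnes-compsFuel (suc fuel) (suc n) (s≤s n≤fuel) k = begin
  countWithOnes k (concatMap startingWith (upTo (suc n)))
    ≡⟨ countWithOnes-concatMap k startingWith (upTo (suc n)) ⟩
  sum (map (countWithOnes k ∘ startingWith) (upTo (suc n)))
    ≡⟨ sum-map-applyUpTo (suc n) (countWithOnes k ∘ startingWith) id ⟩
  countWithOnes k (map (1 ∷_) (compsFuel fuel n))
    + ∑< n (λ i → countWithOnes k (map (suc (suc i) ∷_) (compsFuel fuel (n ∸ suc i))))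
    ≡⟨ cong₂ _+_ (startingWithOne k) (∑<-cong n startingWithTwoOrMore) ⟩
  shift k (weakSum k) (suc n) + ∑< n (λ i → fibCount k (n ∸ suc i))
    ≡⟨ cong (λ t → shift k (weakSum k) (suc n) + t) (∑<-reverse n (fibCount k)) ⟩
  shift k (weakSum k) (suc n) + ∑< n (fibCount k)
    ≡⟨ sym (fibCount-suc k n) ⟩
  fibCount k (suc n) ∎
  where
  open ≡-Reasoning
  startingWith : ℕ → List (List ℕ)
  startingWith i = map (suc i ∷_) (compsFuel fuel (n ∸ i))
  startingWithOne : ∀ k → countWithOnes k (map (1 ∷_) (compsFuel fuel n)) ≡ shift k (weakSum k) (suc n)
  startingWithOne zero    = countWithOnes-1∷-zero (compsFuel fuel n)
  startingWithOne (suc k) = trans (countWithOnes-map (1 ∷_) (λ _ → refl) (compsFuel fuel n))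
                                  (countWithOnes-compsFuel fuel n n≤fuel k)
  startingWithTwoOrMore : ∀ i →
    countWithOnes k (map (suc (suc i) ∷_) (compsFuel fuel (n ∸ suc i))) ≡ fibCount k (n ∸ suc i)
  startingWithTwoOrMore i =
    trans (countWithOnes-map (suc (suc i) ∷_) (λ _ → refl) (compsFuel fuel (n ∸ suc i)))
          (countWithOnes-compsFuel fuel (n ∸ suc i) (≤-trans (m∸n≤m n (suc i)) n≤fuel) k)

fibConvolution-weakSum : ∀ r s m → s ℤ.+ + r ≡ + m → fibConvolution r s ≡ weakSum r m
fibConvolution-weakSum r s m eq rewrite eq = refl

exponent-sum : ∀ k m → ((+ (k + m) - + (2 * k)) - + 1) ℤ.+ + suc k ≡ + m
exponent-sum k m rewrite ℤ.pos-+ k m | ℤ.pos-* 2 k | ℤ.pos-+ 1 k = simplify (+ k) (+ m)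
  where
  simplify : ∀ (x y : ℤ) → ((x ℤ.+ y - + 2 ℤ.* x) - + 1) ℤ.+ (+ 1 ℤ.+ x) ≡ y
  simplify = ℤ-Solver.solve-∀

-- The identity also holds for n = 0.
mainTheorem8 : (n k : ℕ) → 1 ≤ n → k ≤ n →
    c n k ≡ fibConvolution (suc k) ((+ n - + (2 Data.Nat.* k)) - + 1)
mainTheorem8 n k _ k≤n = begin
  c n k                   ≡⟨ countWithOnes-compsFuel n n ≤-refl k ⟩
  fibCount k n            ≡⟨ shift-≥ (weakSum (suc k)) k≤n ⟩
  weakSum (suc k) (n ∸ k) ≡⟨ sym (fibConvolution-weakSum (suc k) s (n ∸ k) exponents) ⟩
  fibConvolution (suc k) s ∎
  where
  open ≡-Reasoning
  s : ℤ
  s = (+ n - + (2 * k)) - + 1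
  exponents : s ℤ.+ + suc k ≡ + (n ∸ k)
  exponents = subst (λ t → ((+ t - + (2 * k)) - + 1) ℤ.+ + suc k ≡ + (n ∸ k))
                    (m+[n∸m]≡n k≤n) (exponent-sum k (n ∸ k))
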